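{- Let $k\ge 2$ and let $\mathcal{T}$ be the set of all small subsets of $V(G_k)$. Then $\mathcal{T}$ is an $\operatorname{mm}$-tangle of order $k$ in $G_k$, i.e.: (T1) for every $S\subseteq V(G_k)$ with $\operatorname{mm}(S)\le k-1$, one of $S$ and $V(G_k)\setminus S$ is in $\mathcal{T}$; (T2) for all $S_1,S_2,S_3\in\mathcal{T}$, $S_1\cup S_2\cup S_3\ne V(G_k)$; (T3) for every $x\in V(G_k)$, $V(G_k)\setminus\{x\}\notin\mathcal{T}$.
   Context: $G_k$ is the $k\times k$-grid with vertex set $\{(i,j):1\le i,j\le k\}$ and edges $(i,j)(i',j')$ with $|i-i'|+|j-j'|=1$. $R_j=\{(i,j):1\le i\le k\}$ is the $j$-th row. For $X\subseteq V(G_k)$, $\operatorname{mm}(X)$ is the size of a maximum matching in $G_k$ among the edges with one end in $X$ and the other in $V(G_k)\setminus X$. A set $X\subseteq V(G_k)$ is small if $\operatorname{mm}(X)<k$ and $R_i\not\subseteq X$ for all $i=1,\dots,k$. -}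

module Defs where

open import Data.Nat using (ℕ; suc; _+_; _∸_; _≤_; _<_; ∣_-_∣)
open import Data.Fin using (Fin; toℕ; _≟_)
open import Data.Bool using (Bool; true; false; not; _∧_; _∨_)
open import Data.Product using (_×_; _,_; proj₁; proj₂)
open import Data.Sum using (_⊎_)
open import Data.List using (List; length; concatMap; _∷_; [])
open import Data.List.Relation.Unary.All using (All)
open import Data.List.Relation.Unary.Unique.Propositional using (Unique)
open import Relation.Binary.PropositionalEquality using (_≡_)
open import Relation.Nullary using (¬_)
open import Relation.Nullary.Decidable using (⌊_⌋)

-- Vertices of the k×k grid G_k, 0-indexed: (i , j) with i, j ∈ Fin k
-- (the paper's (i+1, j+1)).
Vertex : ℕ → Set
Vertex k = Fin k × Fin k

VSet : ℕ → Set
VSet k = Vertex k → Bool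

Adj : ∀ {k} → Vertex k → Vertex k → Set
Adj (i , j) (i' , j') = ∣ toℕ i - toℕ i' ∣ + ∣ toℕ j - toℕ j' ∣ ≡ 1

CutEdge : ∀ {k} → VSet k → Vertex k × Vertex k → Set
CutEdge X (u , v) = Adj u v × X u ≡ true × X v ≡ false

endpoints : ∀ {k} → Vertex k × Vertex k → List (Vertex k)
endpoints (u , v) = u ∷ v ∷ []

CutMatching : ∀ {k} → VSet k → List (Vertex k × Vertex k) → Set
CutMatching X M = All (CutEdge X) M × Unique (concatMap endpoints M)

mm≤ : ∀ {k} → VSet k → ℕ → Set
mm≤ X m = ∀ M → CutMatching X M → length M ≤ m

mm< : ∀ {k} → VSet k → ℕ → Set
mm< X m = ∀ M → CutMatching X M → length M < m

RowIn : ∀ {k} → Fin k → VSet k → Set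
RowIn j X = ∀ i → X (i , j) ≡ true

Small : (k : ℕ) → VSet k → Set
Small k X = mm< X k × (∀ j → ¬ RowIn j X)

complement : ∀ {k} → VSet k → VSet k
complement X v = not (X v)

allBut : ∀ {k} → Vertex k → VSet k
allBut (a , b) (i , j) = not (⌊ i ≟ a ⌋ ∧ ⌊ j ≟ b ⌋)

Covers3 : ∀ {k} → VSet k → VSet k → VSet k → Set
Covers3 S₁ S₂ S₃ = ∀ v → (S₁ v ∨ S₂ v ∨ S₃ v) ≡ true

IsMMTangleOfSmall : ℕ → Set
IsMMTangleOfSmall k =
  (∀ (S : VSet k) → mm≤ S (k ∸ 1) → Small k S ⊎ Small k (complement S))
  × (∀ (S₁ S₂ S₃ : VSet k) → Small k S₁ → Small k S₂ → Small k S₃ → ¬ Covers3 S₁ S₂ S₃)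
  × (∀ (x : Vertex k) → ¬ Small k (allBut x))

module Submission where

-- If S contains no row it is small.  If S contains a row, every column crosses
-- from S to its complement, so a row inside the complement would give k disjoint vertical cut edges;
-- and S and its complement have the same cut.  V ∖ {x} contains a row because k ≥ 2.
--
-- (T2): if three sets cover an n×n subsquare and none contains a row of it, one of them has n disjoint cut
-- edges inside the square; for n = k this contradicts mm < k.  By induction on n: a set containing a column
-- gives a cut edge in every row.  Otherwise, if at some corner every set meets the row or the column through
-- it, remove that row and column, apply induction and add a cut edge on them.  If this fails at three
-- corners, a single set misses the whole boundary.  Each other set either has a cut edge in every row or
-- column, or misses a full row ρ and a full column γ; then every boundary point of the set joins the cross
-- ρ ∪ γ by a segment, and turning all segments clockwise, resp. anticlockwise, gives two matchings
-- (pinwheels) whose sizes add up to its number of boundary points.  The two sets other than the one missing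
-- the boundary cover all of it, so one of their pinwheels has n edges.

open import Defs
open import Data.Bool using (Bool; true; false; not; _∧_; _∨_; T)
open import Data.Bool.Properties using (¬-not; not-injective; ∨-zeroʳ; ∧-zeroʳ) renaming (_≟_ to _≟ᵇ_)
open import Data.Empty using (⊥-elim)
open import Data.Fin as Fin using (Fin; zero; suc; toℕ; fromℕ<)
open import Data.Fin.Properties using (toℕ-fromℕ<; toℕ-injective; toℕ<n)
open import Data.List using (List; []; _∷_; length; _++_; concatMap; map)
open import Data.List.Membership.Propositional using () renaming (_∈_ to _∈ₗ_)
open import Data.List.Properties using (length-++; length-map; concatMap-++)
open import Data.List.Relation.Unary.All as All using (All; []; _∷_)
import Data.List.Relation.Unary.All.Properties as All
open import Data.List.Relation.Unary.AllPairs using ([]; _∷_)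
open import Data.List.Relation.Unary.Unique.Propositional using (Unique)
import Data.List.Relation.Unary.Unique.Propositional.Properties as Unique
open import Data.Nat using (ℕ; zero; suc; _+_; _∸_; _<_; _≤_; z≤n; s≤s; z<s; _<ᵇ_; ∣_-_∣; _<?_; _≤?_)
open import Data.Nat.Properties
open import Algebra.Properties.CommutativeSemigroup +-commutativeSemigroup using () renaming (interchange to +-interchange)
open import Data.Nat.Solver using (module +-*-Solver)
open import Data.Product using (∃; _×_; _,_; proj₁; proj₂; swap)
open import Data.Sum as Sum using (_⊎_; inj₁; inj₂; [_,_]′)
open import Function using (_∘_)
open import Level using (0ℓ)
open import Relation.Binary.PropositionalEquality
open import Relation.Nullary using (¬_; yes; no)
open import Relation.Unary using (Pred; _∈_; _∪_; _∩_; _⊆_; _⊥_)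

all⊎any : ∀ {n} {A B : Fin n → Set} → (∀ i → A i ⊎ B i) → (∀ i → A i) ⊎ ∃ B
all⊎any {zero} _ = inj₁ λ ()
all⊎any {suc n} f with f Fin.zero | all⊎any (λ i → f (Fin.suc i))
... | inj₂ b | _ = inj₂ (Fin.zero , b)
... | inj₁ _ | inj₂ (i , b) = inj₂ (Fin.suc i , b)
... | inj₁ a | inj₁ as = inj₁ λ { Fin.zero → a ; (Fin.suc i) → as i }

third : (a b : Fin 3) → a ≢ b → ∃ λ c → ∀ d → d ≢ a → d ≢ b → d ≡ c
third zero             zero             a≢b = ⊥-elim (a≢b refl)
third zero             (suc zero)       _   = suc (suc zero) , λ
  { zero d≢a _ → ⊥-elim (d≢a refl) ; (suc zero) _ d≢b → ⊥-elim (d≢b refl) ; (suc (suc zero)) _ _ → refl }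
third zero             (suc (suc zero)) _   = suc zero , λ
  { zero d≢a _ → ⊥-elim (d≢a refl) ; (suc zero) _ _ → refl ; (suc (suc zero)) _ d≢b → ⊥-elim (d≢b refl) }
third (suc zero)       zero             _   = suc (suc zero) , λ
  { zero _ d≢b → ⊥-elim (d≢b refl) ; (suc zero) d≢a _ → ⊥-elim (d≢a refl) ; (suc (suc zero)) _ _ → refl }
third (suc zero)       (suc zero)       a≢b = ⊥-elim (a≢b refl)
third (suc zero)       (suc (suc zero)) _   = zero , λ
  { zero _ _ → refl ; (suc zero) d≢a _ → ⊥-elim (d≢a refl) ; (suc (suc zero)) _ d≢b → ⊥-elim (d≢b refl) }
third (suc (suc zero)) zero             _   = suc zero , λ
  { zero _ d≢b → ⊥-elim (d≢b refl) ; (suc zero) _ _ → refl ; (suc (suc zero)) d≢a _ → ⊥-elim (d≢a refl) }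
third (suc (suc zero)) (suc zero)       _   = zero , λ
  { zero _ _ → refl ; (suc zero) _ d≢b → ⊥-elim (d≢b refl) ; (suc (suc zero)) d≢a _ → ⊥-elim (d≢a refl) }
third (suc (suc zero)) (suc (suc zero)) a≢b = ⊥-elim (a≢b refl)

another : (a : Fin 3) → ∃ λ b → a ≢ b
another zero    = suc zero , λ ()
another (suc _) = zero , λ ()

infix 4 _∈[_,_⟩

_∈[_,_⟩ : ℕ → ℕ → ℕ → Set
x ∈[ lo , hi ⟩ = lo ≤ x × x < hi

first∈ : ∀ a n → a ∈[ a , a + suc n ⟩
first∈ a n = ≤-refl , m<m+n a z<s

last∈ : ∀ a n → a + n ∈[ a , a + suc n ⟩
last∈ a n = m≤m+n a n , +-monoʳ-< a ≤-refl

tail⊆ : ∀ {a n x} → x ∈[ suc a , suc a + n ⟩ → x ∈[ a , a + suc n ⟩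
tail⊆ {a} {n} {x} (a<x , x<) = <⇒≤ a<x , subst (x <_) (sym (+-suc a n)) x<

first⊎tail : ∀ {a n x} → x ∈[ a , a + suc n ⟩ → x ≡ a ⊎ x ∈[ suc a , suc a + n ⟩
first⊎tail {a} {n} {x} (a≤x , x<) with m≤n⇒m<n∨m≡n a≤x
... | inj₁ a<x = inj₂ (a<x , subst (x <_) (+-suc a n) x<)
... | inj₂ a≡x = inj₁ (sym a≡x)

≤last : ∀ {x a n} → x < a + suc n → x ≤ a + n
≤last {x} {a} {n} x<a+1+n = ≤-pred (subst (x <_) (+-suc a n) x<a+1+n)

rangeSearch : ∀ {P Q : ℕ → Set} a n → (∀ x → P x ⊎ Q x) →
              (∀ x → x ∈[ a , a + n ⟩ → P x) ⊎ ∃ λ x → x ∈[ a , a + n ⟩ × Q x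
rangeSearch a zero _ = inj₁ λ x (a≤x , x<a+0) → ⊥-elim (≤⇒≯ a≤x (subst (x <_) (+-identityʳ a) x<a+0))
rangeSearch a (suc n) P⊎Q with P⊎Q a | rangeSearch (suc a) n P⊎Q
... | inj₂ q | _ = inj₂ (a , first∈ a n , q)
... | inj₁ _ | inj₂ (x , x∈ , q) = inj₂ (x , tail⊆ x∈ , q)
... | inj₁ p | inj₁ ps = inj₁ λ x x∈ → [ (λ { refl → p }) , ps x ]′ (first⊎tail x∈)

≡⊎≡not : (c b : Bool) → c ≡ b ⊎ c ≡ not b
≡⊎≡not false false = inj₁ refl
≡⊎≡not false true  = inj₂ refl
≡⊎≡not true  false = inj₂ refl
≡⊎≡not true  true  = inj₁ refl

true-false⇒≢ : ∀ {a b : Bool} → a ≡ true → b ≡ false → a ≢ b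
true-false⇒≢ refl refl ()

∧-true : ∀ {a b : Bool} → a ∧ b ≡ true → a ≡ true × b ≡ true
∧-true {true} b≡true = refl , b≡true

∨-true : ∀ {a b : Bool} → a ∨ b ≡ true → a ≡ true ⊎ b ≡ true
∨-true {true}  _         = inj₁ refl
∨-true {false} b≡true    = inj₂ b≡true

<ᵇ-true : ∀ {m n} → (m <ᵇ n) ≡ true → m < n
<ᵇ-true {m} {n} eq = <ᵇ⇒< m n (subst T (sym eq) _)

<ᵇ-false : ∀ {m n} → (m <ᵇ n) ≡ false → n ≤ m
<ᵇ-false eq = ≮⇒≥ λ m<n → subst T eq (<⇒<ᵇ m<n)

adjacentChange : (f : ℕ → Bool) (a d : ℕ) → f a ≢ f (a + d) →
                 ∃ λ z → a ≤ z × suc z ≤ a + d × f z ≢ f (suc z)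
adjacentChange f a zero fa≢fa+0 = ⊥-elim (fa≢fa+0 (cong f (sym (+-identityʳ a))))
adjacentChange f a (suc d) fa≢ with f a ≟ᵇ f (suc a)
... | no fa≢fa+1 = a , ≤-refl , m<m+n a z<s , fa≢fa+1
... | yes fa≡fa+1 with adjacentChange f (suc a) d (λ e → fa≢ (trans fa≡fa+1 (trans e (cong f (sym (+-suc a d))))))
... | z , a<z , z<a+d , change = z , <⇒≤ a<z , subst (suc z ≤_) (sym (+-suc a d)) z<a+d , change

changeWithin : (f : ℕ → Bool) {lo hi p q : ℕ} → lo ≤ p → p ≤ q → q < hi → f p ≢ f q →
               ∃ λ z → lo ≤ z × suc z < hi × f z ≢ f (suc z)
changeWithin f {p = p} {q} lo≤p p≤q q<hi fp≢fq
  with adjacentChange f p (q ∸ p) (subst (λ r → f p ≢ f r) (sym (m+[n∸m]≡n p≤q)) fp≢fq)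
... | z , p≤z , z<q , change =
  z , ≤-trans lo≤p p≤z , ≤-<-trans (subst (suc z ≤_) (m+[n∸m]≡n p≤q) z<q) q<hi , change

changeBetween : (f : ℕ → Bool) {lo hi p q : ℕ} → p ∈[ lo , hi ⟩ → q ∈[ lo , hi ⟩ → f p ≢ f q →
                ∃ λ z → lo ≤ z × suc z < hi × f z ≢ f (suc z)
changeBetween f {p = p} {q} (lo≤p , p<hi) (lo≤q , q<hi) fp≢fq with ≤-total p q
... | inj₁ p≤q = changeWithin f lo≤p p≤q q<hi fp≢fq
... | inj₂ q≤p = changeWithin f lo≤q q≤p p<hi (fp≢fq ∘ sym)

oneIf : Bool → ℕ
oneIf true  = 1
oneIf false = 0

count : (ℕ → Bool) → ℕ → ℕ → ℕ
count f a zero    = 0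
count f a (suc n) = oneIf (f a) + count f (suc a) n

count-all : ∀ (f : ℕ → Bool) a n → (∀ x → x ∈[ a , a + n ⟩ → f x ≡ true) → count f a n ≡ n
count-all f a zero    _   = refl
count-all f a (suc n) all rewrite all a (first∈ a n) =
  cong suc (count-all f (suc a) n λ x x∈ → all x (tail⊆ x∈))

count-∨ : ∀ (f g : ℕ → Bool) a n → count (λ x → f x ∨ g x) a n ≤ count f a n + count g a n
count-∨ f g a zero    = z≤n
count-∨ f g a (suc n) = begin
  oneIf (f a ∨ g a) + count (λ x → f x ∨ g x) (suc a) n
    ≤⟨ +-mono-≤ (oneIf-∨ (f a) (g a)) (count-∨ f g (suc a) n) ⟩
  (oneIf (f a) + oneIf (g a)) + (count f (suc a) n + count g (suc a) n)
    ≡⟨ +-interchange (oneIf (f a)) (oneIf (g a)) _ _ ⟩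
  count f a (suc n) + count g a (suc n) ∎
  where
  open ≤-Reasoning
  oneIf-∨ : ∀ b c → oneIf (b ∨ c) ≤ oneIf b + oneIf c
  oneIf-∨ true  _     = s≤s z≤n
  oneIf-∨ false _     = ≤-refl

count-split-at : ∀ (f : ℕ → Bool) γ a n → f γ ≡ false →
  count f a n ≡ count (λ x → (γ <ᵇ x) ∧ f x) a n + count (λ x → (x <ᵇ γ) ∧ f x) a n
count-split-at f γ a zero    _  = refl
count-split-at f γ a (suc n) fγ =
  trans (cong₂ _+_ (oneIf-split a) (count-split-at f γ (suc a) n fγ))
        (+-interchange (oneIf ((γ <ᵇ a) ∧ f a)) (oneIf ((a <ᵇ γ) ∧ f a)) _ _)
  where
  oneIf-split : ∀ x → oneIf (f x) ≡ oneIf ((γ <ᵇ x) ∧ f x) + oneIf ((x <ᵇ γ) ∧ f x)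
  oneIf-split x with γ <ᵇ x in γ<x | x <ᵇ γ in x<γ
  ... | true  | true  = ⊥-elim (<-asym (<ᵇ-true {γ} γ<x) (<ᵇ-true {x} x<γ))
  ... | true  | false = sym (+-identityʳ _)
  ... | false | true  = refl
  ... | false | false = cong oneIf (trans (cong f (≤-antisym (<ᵇ-false {γ} γ<x) (<ᵇ-false {x} x<γ))) fγ)

-- Corners are counted twice.
perimeter : (ℕ → ℕ → Bool) → ℕ → ℕ → ℕ → ℕ
perimeter g x0 y0 m =
  (count (λ x → g x y0) x0 (suc m) + count (λ x → g x (y0 + m)) x0 (suc m)) +
  (count (λ y → g x0 y) y0 (suc m) + count (λ y → g (x0 + m) y) y0 (suc m))

perimeter-full : ∀ (g : ℕ → ℕ → Bool) x0 y0 m →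
  (∀ x → x ∈[ x0 , x0 + suc m ⟩ → g x y0 ≡ true) → (∀ x → x ∈[ x0 , x0 + suc m ⟩ → g x (y0 + m) ≡ true) →
  (∀ y → y ∈[ y0 , y0 + suc m ⟩ → g x0 y ≡ true) → (∀ y → y ∈[ y0 , y0 + suc m ⟩ → g (x0 + m) y ≡ true) →
  perimeter g x0 y0 m ≡ (suc m + suc m) + (suc m + suc m)
perimeter-full g x0 y0 m bottom top left right =
  cong₂ _+_ (cong₂ _+_ (count-all _ x0 (suc m) bottom) (count-all _ x0 (suc m) top))
            (cong₂ _+_ (count-all _ y0 (suc m) left) (count-all _ y0 (suc m) right))

perimeter-∨ : ∀ (g h : ℕ → ℕ → Bool) x0 y0 m →
  perimeter (λ x y → g x y ∨ h x y) x0 y0 m ≤ perimeter g x0 y0 m + perimeter h x0 y0 m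
perimeter-∨ g h x0 y0 m = begin
  (count (λ x → g x y0 ∨ h x y0) x0 n + count (λ x → g x (y0 + m) ∨ h x (y0 + m)) x0 n) +
  (count (λ y → g x0 y ∨ h x0 y) y0 n + count (λ y → g (x0 + m) y ∨ h (x0 + m) y) y0 n)
    ≤⟨ +-mono-≤ (+-mono-≤ (count-∨ (λ x → g x y0) (λ x → h x y0) x0 n)
                        (count-∨ (λ x → g x (y0 + m)) (λ x → h x (y0 + m)) x0 n))
               (+-mono-≤ (count-∨ (g x0) (h x0) y0 n) (count-∨ (g (x0 + m)) (h (x0 + m)) y0 n)) ⟩
  ((gb + hb) + (gt + ht)) + ((gl + hl) + (gr + hr))
    ≡⟨ cong₂ _+_ (+-interchange gb hb gt ht) (+-interchange gl hl gr hr) ⟩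
  ((gb + gt) + (hb + ht)) + ((gl + gr) + (hl + hr))
    ≡⟨ +-interchange (gb + gt) (hb + ht) (gl + gr) (hl + hr) ⟩
  perimeter g x0 y0 m + perimeter h x0 y0 m ∎
  where
  open ≤-Reasoning
  n = suc m
  gb = count (λ x → g x y0) x0 n
  hb = count (λ x → h x y0) x0 n
  gt = count (λ x → g x (y0 + m)) x0 n
  ht = count (λ x → h x (y0 + m)) x0 n
  gl = count (λ y → g x0 y) y0 n
  hl = count (λ y → h x0 y) y0 n
  gr = count (λ y → g (x0 + m) y) y0 n
  hr = count (λ y → h (x0 + m) y) y0 n

record EndpointSplit (a m a′ c : ℕ) : Set where
  field
    split     : ∀ {x} → x ∈[ a , a + suc m ⟩ → x ∈[ a′ , a′ + m ⟩ ⊎ x ≡ c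
    inner⊆    : ∀ {x} → x ∈[ a′ , a′ + m ⟩ → x ∈[ a , a + suc m ⟩
    endpoint∈ : c ∈[ a , a + suc m ⟩
    endpoint∉ : ¬ (c ∈[ a′ , a′ + m ⟩)
    inner-end : a′ + m ≤ a + suc m

dropFirst : ∀ a m → EndpointSplit a m (suc a) a
dropFirst a m = record
  { split     = Sum.swap ∘ first⊎tail
  ; inner⊆    = tail⊆
  ; endpoint∈ = first∈ a m
  ; endpoint∉ = λ (a<a , _) → <-irrefl refl a<a
  ; inner-end = ≤-reflexive (sym (+-suc a m))
  }

dropLast : ∀ a m → EndpointSplit a m a (a + m)
dropLast a m = record
  { split     = λ (a≤x , x<) → Sum.map₁ (a≤x ,_) (m≤n⇒m<n∨m≡n (≤last x<))
  ; inner⊆    = λ (a≤x , x<a+m) → a≤x , <-trans x<a+m (proj₂ (last∈ a m))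
  ; endpoint∈ = last∈ a m
  ; endpoint∉ = λ (_ , a+m<a+m) → <-irrefl refl a+m<a+m
  ; inner-end = <⇒≤ (proj₂ (last∈ a m))
  }

Adj-sym : ∀ {k} {u v : Vertex k} → Adj u v → Adj v u
Adj-sym {u = a , b} {c , d} adj = trans (cong₂ _+_ (∣-∣-comm (toℕ c) (toℕ a)) (∣-∣-comm (toℕ d) (toℕ b))) adj

∣n-1+n∣≡1 : ∀ n → ∣ n - suc n ∣ ≡ 1
∣n-1+n∣≡1 zero    = refl
∣n-1+n∣≡1 (suc n) = ∣n-1+n∣≡1 n

reverseEnds : ∀ {k} {P : Pred (Vertex k) 0ℓ} M →
              All P (concatMap endpoints M) → All P (concatMap endpoints (map swap M))
reverseEnds []            []               = []
reverseEnds ((u , v) ∷ M) (Pu ∷ Pv ∷ ends) = Pv ∷ Pu ∷ reverseEnds M ends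

reverseUnique : ∀ {k} (M : List (Vertex k × Vertex k)) →
                Unique (concatMap endpoints M) → Unique (concatMap endpoints (map swap M))
reverseUnique []            []                                    = []
reverseUnique ((u , v) ∷ M) ((u≢v ∷ u≢ends) ∷ v≢ends ∷ uniqueEnds) =
  ((u≢v ∘ sym) ∷ reverseEnds M v≢ends) ∷ reverseEnds M u≢ends ∷ reverseUnique M uniqueEnds

module _ {k} {S : VSet k} where

  reverseCutEdges : ∀ M → All (CutEdge (complement S)) M → All (CutEdge S) (map swap M)
  reverseCutEdges []            []                          = []
  reverseCutEdges ((u , v) ∷ M) ((adj , Su , Sv) ∷ cutEdges) =
    (Adj-sym {u = u} adj , not-injective Sv , not-injective Su) ∷ reverseCutEdges M cutEdges

  mm≤-complement : ∀ {n} → mm≤ S n → mm≤ (complement S) n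
  mm≤-complement mm M (cutEdges , uniqueEnds) =
    subst (_≤ _) (length-map swap M) (mm (map swap M) (reverseCutEdges M cutEdges , reverseUnique M uniqueEnds))

module Grid (k' : ℕ) where

  k : ℕ
  k = suc k'

  V : Set
  V = Vertex k

  Region : Set₁
  Region = Pred (ℕ × ℕ) 0ℓ

  coords : V → ℕ × ℕ
  coords (i , j) = toℕ i , toℕ j

  -- Coordinates outside [0, k) are sent to the junk index 0; this is why k is a successor.
  toFin : ℕ → Fin k
  toFin n with n <? k
  ... | yes n<k = fromℕ< n<k
  ... | no  _   = zero

  toℕ-toFin : ∀ {n} → n < k → toℕ (toFin n) ≡ n
  toℕ-toFin {n} n<k with n <? k
  ... | yes n<k′ = toℕ-fromℕ< n<k′
  ... | no  n≮k  = ⊥-elim (n≮k n<k)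

  toFin-toℕ : ∀ i → toFin (toℕ i) ≡ i
  toFin-toℕ i = toℕ-injective (toℕ-toFin (toℕ<n i))

  pt : ℕ → ℕ → V
  pt x y = toFin x , toFin y

  coords-pt : ∀ {x y} → x < k → y < k → coords (pt x y) ≡ (x , y)
  coords-pt x<k y<k = cong₂ _,_ (toℕ-toFin x<k) (toℕ-toFin y<k)

  Adj-↑ : ∀ {x y} → x < k → suc y < k → Adj (pt x y) (pt x (suc y))
  Adj-↑ {x} {y} x<k y+1<k
    rewrite toℕ-toFin x<k | toℕ-toFin (<-trans (n<1+n y) y+1<k) | toℕ-toFin y+1<k | ∣n-n∣≡0 x = ∣n-1+n∣≡1 y

  Adj-→ : ∀ {x y} → suc x < k → y < k → Adj (pt x y) (pt (suc x) y)
  Adj-→ {x} {y} x+1<k y<k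
    rewrite toℕ-toFin (<-trans (n<1+n x) x+1<k) | toℕ-toFin x+1<k | toℕ-toFin y<k | ∣n-n∣≡0 y =
    trans (+-identityʳ _) (∣n-1+n∣≡1 x)

  eachRowHas⊎someRowLacks : ∀ (X : VSet k) b x0 y0 n →
    (∀ y → y ∈[ y0 , y0 + n ⟩ → ∃ λ x → x ∈[ x0 , x0 + n ⟩ × X (pt x y) ≡ b) ⊎
    ∃ λ y → y ∈[ y0 , y0 + n ⟩ × ∀ x → x ∈[ x0 , x0 + n ⟩ → X (pt x y) ≡ not b
  eachRowHas⊎someRowLacks X b x0 y0 n =
    rangeSearch y0 n λ y → Sum.swap (rangeSearch x0 n λ x → Sum.swap (≡⊎≡not (X (pt x y)) b))

  eachColumnHas⊎someColumnLacks : ∀ (X : VSet k) b x0 y0 n →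
    (∀ x → x ∈[ x0 , x0 + n ⟩ → ∃ λ y → y ∈[ y0 , y0 + n ⟩ × X (pt x y) ≡ b) ⊎
    ∃ λ x → x ∈[ x0 , x0 + n ⟩ × ∀ y → y ∈[ y0 , y0 + n ⟩ → X (pt x y) ≡ not b
  eachColumnHas⊎someColumnLacks X b x0 y0 n =
    rangeSearch x0 n λ x → Sum.swap (rangeSearch y0 n λ y → Sum.swap (≡⊎≡not (X (pt x y)) b))

  Square : ℕ → ℕ → ℕ → Region
  Square x0 y0 n c = proj₁ c ∈[ x0 , x0 + n ⟩ × proj₂ c ∈[ y0 , y0 + n ⟩

  -- Cut matchings inside a region

  record CutMatching≥ (X : VSet k) (Q : Region) (n : ℕ) : Set where
    field
      edges         : List (V × V)
      isCutMatching : CutMatching X edges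
      within        : All (λ v → coords v ∈ Q) (concatMap endpoints edges)
      large         : n ≤ length edges

  module _ {X : VSet k} where

    noEdges : ∀ {Q} → CutMatching≥ X Q 0
    noEdges = record { edges = [] ; isCutMatching = [] , [] ; within = [] ; large = z≤n }

    oneEdge : ∀ {Q u v} → Adj u v → X u ≢ X v → coords u ∈ Q → coords v ∈ Q → CutMatching≥ X Q 1
    oneEdge {u = u} {v} adj Xu≢Xv u∈Q v∈Q with X u in Xu | (λ u≡v → Xu≢Xv (cong X u≡v))
    ... | true  | u≢v = record
      { edges         = (u , v) ∷ []
      ; isCutMatching = (adj , Xu , ¬-not (Xu≢Xv ∘ trans Xu ∘ sym)) ∷ [] , (u≢v ∷ []) ∷ [] ∷ []
      ; within        = u∈Q ∷ v∈Q ∷ []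
      ; large         = ≤-refl
      }
    ... | false | u≢v = record
      { edges         = (v , u) ∷ []
      ; isCutMatching = (Adj-sym {u = u} adj , ¬-not (Xu≢Xv ∘ trans Xu ∘ sym) , Xu) ∷ [] , ((u≢v ∘ sym) ∷ []) ∷ [] ∷ []
      ; within        = v∈Q ∷ u∈Q ∷ []
      ; large         = ≤-refl
      }

    weaken : ∀ {Q Q′ n} → Q ⊆ Q′ → CutMatching≥ X Q n → CutMatching≥ X Q′ n
    weaken Q⊆Q′ M = record
      { edges = edges ; isCutMatching = isCutMatching ; within = All.map Q⊆Q′ within ; large = large }
      where open CutMatching≥ M

    lower : ∀ {Q m n} → m ≤ n → CutMatching≥ X Q n → CutMatching≥ X Q m
    lower m≤n M = record
      { edges = edges ; isCutMatching = isCutMatching ; within = within ; large = ≤-trans m≤n large }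
      where open CutMatching≥ M

    disjointUnion : ∀ {Q₁ Q₂ m n} → Q₁ ⊥ Q₂ →
                    CutMatching≥ X Q₁ m → CutMatching≥ X Q₂ n → CutMatching≥ X (Q₁ ∪ Q₂) (m + n)
    disjointUnion {Q₁} {Q₂} Q₁⊥Q₂ M N = record
      { edges         = M.edges ++ N.edges
      ; isCutMatching = All.++⁺ (proj₁ M.isCutMatching) (proj₁ N.isCutMatching)
                      , subst Unique (sym ends-++)
                          (Unique.++⁺ (proj₂ M.isCutMatching) (proj₂ N.isCutMatching) apart)
      ; within        = subst (All _) (sym ends-++) (All.++⁺ (All.map inj₁ M.within) (All.map inj₂ N.within))
      ; large         = subst (_ ≤_) (sym (length-++ M.edges)) (+-mono-≤ M.large N.large)
      }
      where
      module M = CutMatching≥ M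
      module N = CutMatching≥ N
      ends-++ = concatMap-++ endpoints M.edges N.edges
      apart : ∀ {v} → ¬ (v ∈ₗ concatMap endpoints M.edges × v ∈ₗ concatMap endpoints N.edges)
      apart (v∈M , v∈N) = Q₁⊥Q₂ (All.lookup M.within v∈M , All.lookup N.within v∈N)

    lineCut : ∀ (ℓ : ℕ → V) {Q lo hi p q} →
              (∀ z → lo ≤ z → suc z < hi → Adj (ℓ z) (ℓ (suc z))) →
              (∀ z → z ∈[ lo , hi ⟩ → coords (ℓ z) ∈ Q) →
              p ∈[ lo , hi ⟩ → q ∈[ lo , hi ⟩ → X (ℓ p) ≢ X (ℓ q) → CutMatching≥ X Q 1
    lineCut ℓ adjacent onQ p∈ q∈ differ with changeBetween (X ∘ ℓ) p∈ q∈ differ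
    ... | z , lo≤z , z+1<hi , change =
      oneEdge (adjacent z lo≤z z+1<hi) change
              (onQ z (lo≤z , <-trans (n<1+n z) z+1<hi)) (onQ (suc z) (≤-trans lo≤z (n≤1+n z) , z+1<hi))

    columnCut : ∀ {Q x lo hi y y′} → x < k → hi ≤ k → (∀ z → z ∈[ lo , hi ⟩ → (x , z) ∈ Q) →
                y ∈[ lo , hi ⟩ → y′ ∈[ lo , hi ⟩ → X (pt x y) ≡ true → X (pt x y′) ≡ false →
                CutMatching≥ X Q 1
    columnCut {Q} {x} x<k hi≤k onQ y∈ y′∈ Xin Xout =
      lineCut (pt x) (λ z _ z+1<hi → Adj-↑ x<k (<-≤-trans z+1<hi hi≤k))
              (λ z z∈ → subst (_∈ Q) (sym (coords-pt x<k (<-≤-trans (proj₂ z∈) hi≤k))) (onQ z z∈))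
              y∈ y′∈ (true-false⇒≢ Xin Xout)

    rowCut : ∀ {Q y lo hi x x′} → y < k → hi ≤ k → (∀ z → z ∈[ lo , hi ⟩ → (z , y) ∈ Q) →
             x ∈[ lo , hi ⟩ → x′ ∈[ lo , hi ⟩ → X (pt x y) ≡ true → X (pt x′ y) ≡ false →
             CutMatching≥ X Q 1
    rowCut {Q} {y} y<k hi≤k onQ x∈ x′∈ Xin Xout =
      lineCut (λ z → pt z y) (λ z _ z+1<hi → Adj-→ (<-≤-trans z+1<hi hi≤k) y<k)
              (λ z z∈ → subst (_∈ Q) (sym (coords-pt (<-≤-trans (proj₂ z∈) hi≤k) y<k)) (onQ z z∈))
              x∈ x′∈ (true-false⇒≢ Xin Xout)

    stack : ∀ (key : ℕ × ℕ → ℕ) (p : ℕ → Bool) {Q} a n →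
            (∀ x → x ∈[ a , a + n ⟩ → p x ≡ true → CutMatching≥ X (Q ∩ λ c → key c ≡ x) 1) →
            CutMatching≥ X (Q ∩ λ c → a ≤ key c) (count p a n)
    stack key p a zero    _     = noEdges
    stack key p a (suc n) piece with p a in pa | stack key p (suc a) n (λ x x∈ → piece x (tail⊆ x∈))
    ... | false | rest = weaken (λ (q , a<key) → q , <⇒≤ a<key) rest
    ... | true  | rest =
      weaken (λ { (inj₁ (q , key≡a)) → q , ≤-reflexive (sym key≡a) ; (inj₂ (q , a<key)) → q , <⇒≤ a<key })
             (disjointUnion (λ ((_ , key≡a) , (_ , a<key)) → <-irrefl (sym key≡a) a<key)
                            (piece a (first∈ a n) pa) rest)

    columnsCut : ∀ (p : ℕ → Bool) {Q} a n lo hi → a + n ≤ k → hi ≤ k →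
      (∀ x → x ∈[ a , a + n ⟩ → p x ≡ true → ∃ λ y → y ∈[ lo , hi ⟩ × X (pt x y) ≡ true) →
      (∀ x → x ∈[ a , a + n ⟩ → p x ≡ true → ∃ λ y → y ∈[ lo , hi ⟩ × X (pt x y) ≡ false) →
      (∀ x y → x ∈[ a , a + n ⟩ → p x ≡ true → y ∈[ lo , hi ⟩ → (x , y) ∈ Q) →
      CutMatching≥ X Q (count p a n)
    columnsCut p a n lo hi a+n≤k hi≤k meets misses onQ = weaken proj₁ (stack proj₁ p a n piece)
      where
      piece : ∀ x → x ∈[ a , a + n ⟩ → p x ≡ true → CutMatching≥ X (_ ∩ λ c → proj₁ c ≡ x) 1
      piece x x∈ px with meets x x∈ px | misses x x∈ px
      ... | y , y∈ , Xin | y′ , y′∈ , Xout =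
        columnCut (<-≤-trans (proj₂ x∈) a+n≤k) hi≤k (λ z z∈ → onQ x z x∈ px z∈ , refl) y∈ y′∈ Xin Xout

    rowsCut : ∀ (p : ℕ → Bool) {Q} a n lo hi → a + n ≤ k → hi ≤ k →
      (∀ y → y ∈[ a , a + n ⟩ → p y ≡ true → ∃ λ x → x ∈[ lo , hi ⟩ × X (pt x y) ≡ true) →
      (∀ y → y ∈[ a , a + n ⟩ → p y ≡ true → ∃ λ x → x ∈[ lo , hi ⟩ × X (pt x y) ≡ false) →
      (∀ x y → y ∈[ a , a + n ⟩ → p y ≡ true → x ∈[ lo , hi ⟩ → (x , y) ∈ Q) →
      CutMatching≥ X Q (count p a n)
    rowsCut p a n lo hi a+n≤k hi≤k meets misses onQ = weaken proj₁ (stack proj₂ p a n piece)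
      where
      piece : ∀ y → y ∈[ a , a + n ⟩ → p y ≡ true → CutMatching≥ X (_ ∩ λ c → proj₂ c ≡ y) 1
      piece y y∈ py with meets y y∈ py | misses y y∈ py
      ... | x , x∈ , Xin | x′ , x′∈ , Xout =
        rowCut (<-≤-trans (proj₂ y∈) a+n≤k) hi≤k (λ z z∈ → onQ z y y∈ py z∈ , refl) x∈ x′∈ Xin Xout

    mixedRowsCut : ∀ {x0 y0 n} → x0 + n ≤ k → y0 + n ≤ k →
      (∀ y → y ∈[ y0 , y0 + n ⟩ → ∃ λ x → x ∈[ x0 , x0 + n ⟩ × X (pt x y) ≡ true) →
      (∀ y → y ∈[ y0 , y0 + n ⟩ → ∃ λ x → x ∈[ x0 , x0 + n ⟩ × X (pt x y) ≡ false) →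
      CutMatching≥ X (Square x0 y0 n) n
    mixedRowsCut {x0} {y0} {n} x-fits y-fits meets misses =
      lower (≤-reflexive (sym (count-all _ y0 n λ _ _ → refl)))
        (rowsCut (λ _ → true) y0 n x0 (x0 + n) y-fits x-fits
                 (λ y y∈ _ → meets y y∈) (λ y y∈ _ → misses y y∈) (λ _ _ y∈ _ x∈ → x∈ , y∈))

    mixedColumnsCut : ∀ {x0 y0 n} → x0 + n ≤ k → y0 + n ≤ k →
      (∀ x → x ∈[ x0 , x0 + n ⟩ → ∃ λ y → y ∈[ y0 , y0 + n ⟩ × X (pt x y) ≡ true) →
      (∀ x → x ∈[ x0 , x0 + n ⟩ → ∃ λ y → y ∈[ y0 , y0 + n ⟩ × X (pt x y) ≡ false) →
      CutMatching≥ X (Square x0 y0 n) n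
    mixedColumnsCut {x0} {y0} {n} x-fits y-fits meets misses =
      lower (≤-reflexive (sym (count-all _ x0 n λ _ _ → refl)))
        (columnsCut (λ _ → true) x0 n y0 (y0 + n) x-fits y-fits
                    (λ x x∈ _ → meets x x∈) (λ x x∈ _ → misses x x∈) (λ _ _ x∈ _ y∈ → x∈ , y∈))

  -- A point of X on the top side right of γ is joined to row ρ by a vertical
  -- segment containing a cut edge, one on the left side above ρ to column γ by a horizontal segment, and so
  -- on around the square; these segments lie in pairwise disjoint quadrants.
  module Pinwheel {X : VSet k} {x0 y0 m ρ γ : ℕ} (x-fits : x0 + suc m ≤ k) (y-fits : y0 + suc m ≤ k)
                  (ρ∈ : ρ ∈[ y0 , y0 + suc m ⟩) (γ∈ : γ ∈[ x0 , x0 + suc m ⟩)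
                  (rowρ : ∀ x → x ∈[ x0 , x0 + suc m ⟩ → X (pt x ρ) ≡ false)
                  (colγ : ∀ y → y ∈[ y0 , y0 + suc m ⟩ → X (pt γ y) ≡ false) where

    n : ℕ
    n = suc m

    top bottom left right : ℕ → Bool
    top    x = X (pt x (y0 + m))
    bottom x = X (pt x y0)
    left   y = X (pt x0 y)
    right  y = X (pt (x0 + m) y)

    Top Bottom Left Right : (ℕ → Set) → Region
    Top    S c = Square x0 y0 n c × S (proj₁ c) × ρ ≤ proj₂ c
    Bottom S c = Square x0 y0 n c × S (proj₁ c) × proj₂ c ≤ ρ
    Left   S c = Square x0 y0 n c × S (proj₂ c) × proj₁ c ≤ γ
    Right  S c = Square x0 y0 n c × S (proj₂ c) × γ ≤ proj₁ c

    module _ {S : ℕ → Set} (s : ℕ → Bool) (sound : ∀ {z} → s z ≡ true → S z) where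

      fromTop : CutMatching≥ X (Top S) (count (λ x → s x ∧ top x) x0 n)
      fromTop = columnsCut _ x0 n ρ (y0 + n) x-fits y-fits
        (λ _ _ sx∧tx → y0 + m , (≤last (proj₂ ρ∈) , proj₂ (last∈ y0 m)) , proj₂ (∧-true sx∧tx))
        (λ x x∈ _ → ρ , (≤-refl , proj₂ ρ∈) , rowρ x x∈)
        (λ _ _ x∈ sx∧tx (ρ≤y , y<) → (x∈ , ≤-trans (proj₁ ρ∈) ρ≤y , y<) , sound (proj₁ (∧-true sx∧tx)) , ρ≤y)

      fromBottom : CutMatching≥ X (Bottom S) (count (λ x → s x ∧ bottom x) x0 n)
      fromBottom = columnsCut _ x0 n y0 (suc ρ) x-fits (≤-trans (proj₂ ρ∈) y-fits)
        (λ _ _ sx∧bx → y0 , (≤-refl , s≤s (proj₁ ρ∈)) , proj₂ (∧-true sx∧bx))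
        (λ x x∈ _ → ρ , (proj₁ ρ∈ , ≤-refl) , rowρ x x∈)
        (λ _ _ x∈ sx∧bx (y0≤y , y≤ρ) → (x∈ , y0≤y , ≤-<-trans (≤-pred y≤ρ) (proj₂ ρ∈)) ,
                                       sound (proj₁ (∧-true sx∧bx)) , ≤-pred y≤ρ)

      fromLeft : CutMatching≥ X (Left S) (count (λ y → s y ∧ left y) y0 n)
      fromLeft = rowsCut _ y0 n x0 (suc γ) y-fits (≤-trans (proj₂ γ∈) x-fits)
        (λ _ _ sy∧ly → x0 , (≤-refl , s≤s (proj₁ γ∈)) , proj₂ (∧-true sy∧ly))
        (λ y y∈ _ → γ , (proj₁ γ∈ , ≤-refl) , colγ y y∈)
        (λ _ _ y∈ sy∧ly (x0≤x , x≤γ) → ((x0≤x , ≤-<-trans (≤-pred x≤γ) (proj₂ γ∈)) , y∈) ,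
                                       sound (proj₁ (∧-true sy∧ly)) , ≤-pred x≤γ)

      fromRight : CutMatching≥ X (Right S) (count (λ y → s y ∧ right y) y0 n)
      fromRight = rowsCut _ y0 n γ (x0 + n) y-fits x-fits
        (λ _ _ sy∧ry → x0 + m , (≤last (proj₂ γ∈) , proj₂ (last∈ x0 m)) , proj₂ (∧-true sy∧ry))
        (λ y y∈ _ → γ , (≤-refl , proj₂ γ∈) , colγ y y∈)
        (λ _ _ y∈ sy∧ry (γ≤x , x<) → ((≤-trans (proj₁ γ∈) γ≤x , x<) , y∈) , sound (proj₁ (∧-true sy∧ry)) , γ≤x)

    topʳ topˡ bottomʳ bottomˡ leftᵘ leftᵈ rightᵘ rightᵈ : ℕ
    topʳ    = count (λ x → (γ <ᵇ x) ∧ top x) x0 n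
    topˡ    = count (λ x → (x <ᵇ γ) ∧ top x) x0 n
    bottomʳ = count (λ x → (γ <ᵇ x) ∧ bottom x) x0 n
    bottomˡ = count (λ x → (x <ᵇ γ) ∧ bottom x) x0 n
    leftᵘ   = count (λ y → (ρ <ᵇ y) ∧ left y) y0 n
    leftᵈ   = count (λ y → (y <ᵇ ρ) ∧ left y) y0 n
    rightᵘ  = count (λ y → (ρ <ᵇ y) ∧ right y) y0 n
    rightᵈ  = count (λ y → (y <ᵇ ρ) ∧ right y) y0 n

    clockwise : CutMatching≥ X (Square x0 y0 n) (((topʳ + bottomˡ) + leftᵘ) + rightᵈ)
    clockwise = weaken [ [ [ proj₁ , proj₁ ]′ , proj₁ ]′ , proj₁ ]′
      (disjointUnion
        (λ { (inj₁ (inj₁ (_ , _ , ρ≤y)) , (_ , y<ρ , _)) → ≤⇒≯ ρ≤y y<ρ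
           ; (inj₁ (inj₂ (_ , x<γ , _)) , (_ , _ , γ≤x)) → <⇒≱ x<γ γ≤x
           ; (inj₂ (_ , ρ<y , _)        , (_ , y<ρ , _)) → <-asym ρ<y y<ρ })
        (disjointUnion
          (λ { (inj₁ (_ , γ<x , _) , (_ , _ , x≤γ)) → <⇒≱ γ<x x≤γ
             ; (inj₂ (_ , _ , y≤ρ) , (_ , ρ<y , _)) → ≤⇒≯ y≤ρ ρ<y })
          (disjointUnion (λ ((_ , γ<x , _) , (_ , x<γ , _)) → <-asym γ<x x<γ)
            (fromTop (γ <ᵇ_) (<ᵇ-true {γ})) (fromBottom (_<ᵇ γ) λ {x} → <ᵇ-true {x}))
          (fromLeft (ρ <ᵇ_) (<ᵇ-true {ρ})))
        (fromRight (_<ᵇ ρ) λ {y} → <ᵇ-true {y}))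

    anticlockwise : CutMatching≥ X (Square x0 y0 n) (((topˡ + bottomʳ) + leftᵈ) + rightᵘ)
    anticlockwise = weaken [ [ [ proj₁ , proj₁ ]′ , proj₁ ]′ , proj₁ ]′
      (disjointUnion
        (λ { (inj₁ (inj₁ (_ , x<γ , _)) , (_ , _ , γ≤x)) → <⇒≱ x<γ γ≤x
           ; (inj₁ (inj₂ (_ , _ , y≤ρ)) , (_ , ρ<y , _)) → ≤⇒≯ y≤ρ ρ<y
           ; (inj₂ (_ , y<ρ , _)        , (_ , ρ<y , _)) → <-asym y<ρ ρ<y })
        (disjointUnion
          (λ { (inj₁ (_ , _ , ρ≤y) , (_ , y<ρ , _)) → ≤⇒≯ ρ≤y y<ρ
             ; (inj₂ (_ , γ<x , _) , (_ , _ , x≤γ)) → <⇒≱ γ<x x≤γ })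
          (disjointUnion (λ ((_ , x<γ , _) , (_ , γ<x , _)) → <-asym x<γ γ<x)
            (fromTop (_<ᵇ γ) λ {x} → <ᵇ-true {x}) (fromBottom (γ <ᵇ_) (<ᵇ-true {γ})))
          (fromLeft (_<ᵇ ρ) λ {y} → <ᵇ-true {y}))
        (fromRight (ρ <ᵇ_) (<ᵇ-true {ρ})))

    perimeter-split : perimeter (λ x y → X (pt x y)) x0 y0 m ≡
                      (((topʳ + bottomˡ) + leftᵘ) + rightᵈ) + (((topˡ + bottomʳ) + leftᵈ) + rightᵘ)
    perimeter-split = begin
      (count bottom x0 n + count top x0 n) + (count left y0 n + count right y0 n)
        ≡⟨ cong₂ _+_ (cong₂ _+_ (count-split-at bottom γ x0 n (colγ y0 (first∈ y0 m)))
                                (count-split-at top γ x0 n (colγ (y0 + m) (last∈ y0 m))))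
                     (cong₂ _+_ (count-split-at left ρ y0 n (rowρ x0 (first∈ x0 m)))
                                (count-split-at right ρ y0 n (rowρ (x0 + m) (last∈ x0 m)))) ⟩
      ((bottomʳ + bottomˡ) + (topʳ + topˡ)) + ((leftᵘ + leftᵈ) + (rightᵘ + rightᵈ))
        ≡⟨ solve 8 (λ bʳ bˡ tʳ tˡ lᵘ lᵈ rᵘ rᵈ → ((bʳ :+ bˡ) :+ (tʳ :+ tˡ)) :+ ((lᵘ :+ lᵈ) :+ (rᵘ :+ rᵈ)) :=
                     (((tʳ :+ bˡ) :+ lᵘ) :+ rᵈ) :+ (((tˡ :+ bʳ) :+ lᵈ) :+ rᵘ))
                   refl bottomʳ bottomˡ topʳ topˡ leftᵘ leftᵈ rightᵘ rightᵈ ⟩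
      (((topʳ + bottomˡ) + leftᵘ) + rightᵈ) + (((topˡ + bottomʳ) + leftᵈ) + rightᵘ) ∎
      where open ≡-Reasoning
            open +-*-Solver

    large⊎short : CutMatching≥ X (Square x0 y0 n) n ⊎ perimeter (λ x y → X (pt x y)) x0 y0 m ≤ m + m
    large⊎short with n ≤? ((topʳ + bottomˡ) + leftᵘ) + rightᵈ | n ≤? ((topˡ + bottomʳ) + leftᵈ) + rightᵘ
    ... | yes n≤P | _      = inj₁ (lower n≤P clockwise)
    ... | no  _   | yes n≤P′ = inj₁ (lower n≤P′ anticlockwise)
    ... | no  n≰P | no n≰P′  =
      inj₂ (subst (_≤ m + m) (sym perimeter-split) (+-mono-≤ (≤-pred (≰⇒> n≰P)) (≤-pred (≰⇒> n≰P′))))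

  largeOrShortPerimeter : ∀ {X : VSet k} {x0 y0 m} → x0 + suc m ≤ k → y0 + suc m ≤ k →
    (∀ y → y ∈[ y0 , y0 + suc m ⟩ → ∃ λ x → x ∈[ x0 , x0 + suc m ⟩ × X (pt x y) ≡ false) →
    (∀ x → x ∈[ x0 , x0 + suc m ⟩ → ∃ λ y → y ∈[ y0 , y0 + suc m ⟩ × X (pt x y) ≡ false) →
    CutMatching≥ X (Square x0 y0 (suc m)) (suc m) ⊎ perimeter (λ x y → X (pt x y)) x0 y0 m ≤ m + m
  largeOrShortPerimeter {X} {x0} {y0} {m} x-fits y-fits rowsOpen columnsOpen
    with eachRowHas⊎someRowLacks X true x0 y0 (suc m)
  ... | inj₁ rowsMeet = inj₁ (mixedRowsCut x-fits y-fits rowsMeet rowsOpen)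
  ... | inj₂ (ρ , ρ∈ , rowρ)
    with eachColumnHas⊎someColumnLacks X true x0 y0 (suc m)
  ...   | inj₁ columnsMeet = inj₁ (mixedColumnsCut x-fits y-fits columnsMeet columnsOpen)
  ...   | inj₂ (γ , γ∈ , colγ) = Pinwheel.large⊎short x-fits y-fits ρ∈ γ∈ rowρ colγ

  -- Three sets covering a square

  module ThreeSets (X : Fin 3 → VSet k) where

    Covered RowsOpen ColumnsOpen Large : ℕ → ℕ → ℕ → Set
    Covered     x0 y0 n = ∀ x y → (x , y) ∈ Square x0 y0 n → ∃ λ t → X t (pt x y) ≡ true
    RowsOpen    x0 y0 n = ∀ t y → y ∈[ y0 , y0 + n ⟩ → ∃ λ x → x ∈[ x0 , x0 + n ⟩ × X t (pt x y) ≡ false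
    ColumnsOpen x0 y0 n = ∀ t x → x ∈[ x0 , x0 + n ⟩ → ∃ λ y → y ∈[ y0 , y0 + n ⟩ × X t (pt x y) ≡ false
    Large       x0 y0 n = ∃ λ t → CutMatching≥ (X t) (Square x0 y0 n) n

    missedByAtMostOne : ∀ (L : Pred V 0ℓ) {a b} → (∀ v → L v → ∃ λ t → X t v ≡ true) →
      (∀ t → ∃ λ v → L v × X t v ≡ false) →
      (∀ v → L v → X a v ≡ false) → (∀ v → L v → X b v ≡ false) → a ≡ b
    missedByAtMostOne L {a} {b} covered opened missA missB with a Fin.≟ b
    ... | yes a≡b = a≡b
    ... | no  a≢b with third a b a≢b
    ...   | c , onlyC with opened c
    ...     | v , v∈L , Xcv≡false with covered v v∈L
    ...       | d , Xdv≡true = ⊥-elim (true-false⇒≢ (subst (λ e → X e v ≡ true) d≡c Xdv≡true) Xcv≡false refl)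
      where
      d≢ : ∀ {e} → (∀ v → L v → X e v ≡ false) → d ≢ e
      d≢ miss refl = true-false⇒≢ Xdv≡true (miss v v∈L) refl
      d≡c : d ≡ c
      d≡c = onlyC d (d≢ missA) (d≢ missB)

    rowMissedByAtMostOne : ∀ {x0 y0 n y a b} → Covered x0 y0 n → RowsOpen x0 y0 n → y ∈[ y0 , y0 + n ⟩ →
      (∀ x → x ∈[ x0 , x0 + n ⟩ → X a (pt x y) ≡ false) → (∀ x → x ∈[ x0 , x0 + n ⟩ → X b (pt x y) ≡ false) → a ≡ b
    rowMissedByAtMostOne {x0} {n = n} {y} covered rowsOpen y∈ missA missB =
      missedByAtMostOne (λ v → ∃ λ x → x ∈[ x0 , x0 + n ⟩ × v ≡ pt x y)
        (λ { _ (x , x∈ , refl) → covered x y (x∈ , y∈) })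
        (λ t → let x , x∈ , Xt≡false = rowsOpen t y y∈ in pt x y , (x , x∈ , refl) , Xt≡false)
        (λ { _ (x , x∈ , refl) → missA x x∈ }) (λ { _ (x , x∈ , refl) → missB x x∈ })

    columnMissedByAtMostOne : ∀ {x0 y0 n x a b} → Covered x0 y0 n → ColumnsOpen x0 y0 n → x ∈[ x0 , x0 + n ⟩ →
      (∀ y → y ∈[ y0 , y0 + n ⟩ → X a (pt x y) ≡ false) → (∀ y → y ∈[ y0 , y0 + n ⟩ → X b (pt x y) ≡ false) → a ≡ b
    columnMissedByAtMostOne {y0 = y0} {n} {x} covered columnsOpen x∈ missA missB =
      missedByAtMostOne (λ v → ∃ λ y → y ∈[ y0 , y0 + n ⟩ × v ≡ pt x y)
        (λ { _ (y , y∈ , refl) → covered x y (x∈ , y∈) })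
        (λ t → let y , y∈ , Xt≡false = columnsOpen t x x∈ in pt x y , (y , y∈ , refl) , Xt≡false)
        (λ { _ (y , y∈ , refl) → missA y y∈ }) (λ { _ (y , y∈ , refl) → missB y y∈ })

    missedBoundary⇒large : ∀ {x0 y0 m} → x0 + suc m ≤ k → y0 + suc m ≤ k → Covered x0 y0 (suc m) →
      RowsOpen x0 y0 (suc m) → ColumnsOpen x0 y0 (suc m) → ∀ a →
      (∀ x → x ∈[ x0 , x0 + suc m ⟩ → X a (pt x y0) ≡ false) →
      (∀ x → x ∈[ x0 , x0 + suc m ⟩ → X a (pt x (y0 + m)) ≡ false) →
      (∀ y → y ∈[ y0 , y0 + suc m ⟩ → X a (pt x0 y) ≡ false) →
      (∀ y → y ∈[ y0 , y0 + suc m ⟩ → X a (pt (x0 + m) y) ≡ false) →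
      Large x0 y0 (suc m)
    missedBoundary⇒large {x0} {y0} {m} x-fits y-fits covered rowsOpen columnsOpen a bottom top left right
      with another a
    ... | b , a≢b with third a b a≢b
    ...   | c , onlyC
      with largeOrShortPerimeter x-fits y-fits (rowsOpen b) (columnsOpen b)
         | largeOrShortPerimeter x-fits y-fits (rowsOpen c) (columnsOpen c)
    ...     | inj₁ M | _      = b , M
    ...     | inj₂ _ | inj₁ M = c , M
    ...     | inj₂ short-b | inj₂ short-c = ⊥-elim (<⇒≱ 4m<4n 4n≤4m)
      where
      n = suc m

      Xₚ : Fin 3 → ℕ → ℕ → Bool
      Xₚ t x y = X t (pt x y)

      Xb∨Xc : ℕ → ℕ → Bool
      Xb∨Xc x y = Xₚ b x y ∨ Xₚ c x y

      b∨c : ∀ {x y} → (x , y) ∈ Square x0 y0 n → X a (pt x y) ≡ false → Xb∨Xc x y ≡ true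
      b∨c {x} {y} xy∈ Xa≡false with covered x y xy∈
      ... | d , Xd≡true with d Fin.≟ b
      ...   | yes refl = cong (_∨ Xₚ c x y) Xd≡true
      ...   | no  d≢b  = trans (cong (Xₚ b x y ∨_) (subst (λ e → X e (pt x y) ≡ true) d≡c Xd≡true)) (∨-zeroʳ _)
        where
        d≡c = onlyC d (λ { refl → true-false⇒≢ Xd≡true Xa≡false refl }) d≢b

      4n≤4m : (n + n) + (n + n) ≤ (m + m) + (m + m)
      4n≤4m = begin
        (n + n) + (n + n)
          ≡⟨ sym (perimeter-full Xb∨Xc x0 y0 m (λ x x∈ → b∨c (x∈ , first∈ y0 m) (bottom x x∈))
                                               (λ x x∈ → b∨c (x∈ , last∈ y0 m) (top x x∈))
                                               (λ y y∈ → b∨c (first∈ x0 m , y∈) (left y y∈))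
                                               (λ y y∈ → b∨c (last∈ x0 m , y∈) (right y y∈))) ⟩
        perimeter Xb∨Xc x0 y0 m
          ≤⟨ perimeter-∨ (Xₚ b) (Xₚ c) x0 y0 m ⟩
        perimeter (Xₚ b) x0 y0 m + perimeter (Xₚ c) x0 y0 m
          ≤⟨ +-mono-≤ short-b short-c ⟩
        (m + m) + (m + m) ∎
        where open ≤-Reasoning

      4m<4n : (m + m) + (m + m) < (n + n) + (n + n)
      4m<4n = +-mono-< (+-mono-< (n<1+n m) (n<1+n m)) (+-mono-< (n<1+n m) (n<1+n m))

    -- Row r and column c of the square form an L when peeled off at a corner.
    MeetsL MissesL : ℕ → ℕ → ℕ → ℕ → ℕ → Fin 3 → Set
    MeetsL  x0 y0 n r c t = (∃ λ x → x ∈[ x0 , x0 + n ⟩ × X t (pt x r) ≡ true) ⊎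
                            (∃ λ y → y ∈[ y0 , y0 + n ⟩ × X t (pt c y) ≡ true)
    MissesL x0 y0 n r c t = (∀ x → x ∈[ x0 , x0 + n ⟩ → X t (pt x r) ≡ false) ×
                            (∀ y → y ∈[ y0 , y0 + n ⟩ → X t (pt c y) ≡ false)

    meetsL? : ∀ x0 y0 n r c t → MeetsL x0 y0 n r c t ⊎ MissesL x0 y0 n r c t
    meetsL? x0 y0 n r c t with rangeSearch x0 n (λ x → ≡⊎≡not (X t (pt x r)) false)
                             | rangeSearch y0 n (λ y → ≡⊎≡not (X t (pt c y)) false)
    ... | inj₂ inRow   | _                = inj₁ (inj₁ inRow)
    ... | inj₁ _       | inj₂ inColumn    = inj₁ (inj₂ inColumn)
    ... | inj₁ missRow | inj₁ missColumn  = inj₂ (missRow , missColumn)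

    module Peel {m x0 y0 x0′ y0′ c r} (SX : EndpointSplit x0 m x0′ c) (SY : EndpointSplit y0 m y0′ r)
                (x-fits : x0 + suc m ≤ k) (y-fits : y0 + suc m ≤ k) (covered : Covered x0 y0 (suc m))
                (rowsOpen : RowsOpen x0 y0 (suc m)) (columnsOpen : ColumnsOpen x0 y0 (suc m)) where

      module SX = EndpointSplit SX
      module SY = EndpointSplit SY

      n : ℕ
      n = suc m

      x-fits′ : x0′ + m ≤ k
      x-fits′ = ≤-trans SX.inner-end x-fits

      y-fits′ : y0′ + m ≤ k
      y-fits′ = ≤-trans SY.inner-end y-fits

      inner⊆ : Square x0′ y0′ m ⊆ Square x0 y0 n
      inner⊆ (x∈ , y∈) = SX.inner⊆ x∈ , SY.inner⊆ y∈

      extend : ∀ t → MeetsL x0 y0 n r c t → CutMatching≥ (X t) (Square x0′ y0′ m) m → Large x0 y0 n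
      extend t (inj₁ (x , x∈ , Xin)) M with rowsOpen t r SY.endpoint∈
      ... | x′ , x′∈ , Xout = t , weaken [ proj₁ , inner⊆ ]′ (disjointUnion apart edge M)
        where
        edge : CutMatching≥ (X t) (Square x0 y0 n ∩ λ p → proj₂ p ≡ r) 1
        edge = rowCut (<-≤-trans (proj₂ SY.endpoint∈) y-fits) x-fits (λ z z∈ → (z∈ , SY.endpoint∈) , refl)
                      x∈ x′∈ Xin Xout
        apart : (Square x0 y0 n ∩ λ p → proj₂ p ≡ r) ⊥ Square x0′ y0′ m
        apart ((_ , refl) , (_ , r∈)) = SY.endpoint∉ r∈
      extend t (inj₂ (y , y∈ , Xin)) M with columnsOpen t c SX.endpoint∈
      ... | y′ , y′∈ , Xout = t , weaken [ proj₁ , inner⊆ ]′ (disjointUnion apart edge M)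
        where
        edge : CutMatching≥ (X t) (Square x0 y0 n ∩ λ p → proj₁ p ≡ c) 1
        edge = columnCut (<-≤-trans (proj₂ SX.endpoint∈) x-fits) y-fits (λ z z∈ → (SX.endpoint∈ , z∈) , refl)
                         y∈ y′∈ Xin Xout
        apart : (Square x0 y0 n ∩ λ p → proj₁ p ≡ c) ⊥ Square x0′ y0′ m
        apart ((_ , refl) , (c∈ , _)) = SX.endpoint∉ c∈

      fullInnerRow : ∀ t j → j ∈[ y0′ , y0′ + m ⟩ → (∀ x → x ∈[ x0′ , x0′ + m ⟩ → X t (pt x j) ≡ true) →
                     MeetsL x0 y0 n r c t → Large x0 y0 n
      fullInnerRow t j j∈ rowj meets with rangeSearch y0 n (λ y → ≡⊎≡not (X t (pt c y)) false)
      ... | inj₂ (y , y∈ , Xcy) = t , mixedColumnsCut x-fits y-fits columnsMeet (columnsOpen t)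
        where
        columnsMeet : ∀ x → x ∈[ x0 , x0 + n ⟩ → ∃ λ y → y ∈[ y0 , y0 + n ⟩ × X t (pt x y) ≡ true
        columnsMeet x x∈ with SX.split x∈
        ... | inj₁ x∈′ = j , SY.inner⊆ j∈ , rowj x x∈′
        ... | inj₂ refl = y , y∈ , Xcy
      ... | inj₁ columnc with meets
      ...   | inj₂ (y , y∈ , Xcy) = ⊥-elim (true-false⇒≢ Xcy (columnc y y∈) refl)
      ...   | inj₁ (x , x∈ , Xxr)
        with eachColumnHas⊎someColumnLacks (X t) false x0′ y0′ m
      ...     | inj₁ innerColumnsOpen =
        extend t meets (mixedColumnsCut x-fits′ y-fits′ (λ i i∈ → j , j∈ , rowj i i∈) innerColumnsOpen)
      ...     | inj₂ (i , i∈ , columni) = t , mixedRowsCut x-fits y-fits rowsMeet (rowsOpen t)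
        where
        rowsMeet : ∀ y → y ∈[ y0 , y0 + n ⟩ → ∃ λ x → x ∈[ x0 , x0 + n ⟩ × X t (pt x y) ≡ true
        rowsMeet y y∈ with SY.split y∈
        ... | inj₁ y∈′ = i , SX.inner⊆ i∈ , columni y y∈′
        ... | inj₂ refl = x , x∈ , Xxr

      peel : (x0′ + m ≤ k → y0′ + m ≤ k → Covered x0′ y0′ m → RowsOpen x0′ y0′ m → Large x0′ y0′ m) →
             (∀ t → MeetsL x0 y0 n r c t) → Large x0 y0 n
      peel induction meets
        with all⊎any (λ t → eachRowHas⊎someRowLacks (X t) false x0′ y0′ m)
      ... | inj₂ (t , j , j∈ , rowj) = fullInnerRow t j j∈ rowj (meets t)
      ... | inj₁ innerRowsOpen with induction x-fits′ y-fits′ (λ x y xy∈ → covered x y (inner⊆ xy∈)) innerRowsOpen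
      ...   | t , M = extend t (meets t) M

    cornerStep : ∀ {m x0 y0} →
      (∀ x0′ y0′ → x0′ + m ≤ k → y0′ + m ≤ k → Covered x0′ y0′ m → RowsOpen x0′ y0′ m → Large x0′ y0′ m) →
      x0 + suc m ≤ k → y0 + suc m ≤ k → Covered x0 y0 (suc m) → RowsOpen x0 y0 (suc m) →
      ColumnsOpen x0 y0 (suc m) → Large x0 y0 (suc m)
    cornerStep {m} {x0} {y0} induction x-fits y-fits covered rowsOpen columnsOpen =
      corners (all⊎any (meetsL? x0 y0 n y0 x0)) (all⊎any (meetsL? x0 y0 n y0 (x0 + m)))
              (all⊎any (meetsL? x0 y0 n (y0 + m) x0))
      where
      n = suc m

      peel : ∀ {x0′ y0′ c r} → EndpointSplit x0 m x0′ c → EndpointSplit y0 m y0′ r →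
             (∀ t → MeetsL x0 y0 n r c t) → Large x0 y0 n
      peel SX SY = Peel.peel SX SY x-fits y-fits covered rowsOpen columnsOpen (induction _ _)

      corners : (∀ t → MeetsL x0 y0 n y0 x0 t) ⊎ ∃ (MissesL x0 y0 n y0 x0) →
                (∀ t → MeetsL x0 y0 n y0 (x0 + m) t) ⊎ ∃ (MissesL x0 y0 n y0 (x0 + m)) →
                (∀ t → MeetsL x0 y0 n (y0 + m) x0 t) ⊎ ∃ (MissesL x0 y0 n (y0 + m) x0) → Large x0 y0 n
      corners (inj₁ meets) _            _            = peel (dropFirst x0 m) (dropFirst y0 m) meets
      corners (inj₂ _)     (inj₁ meets) _            = peel (dropLast x0 m) (dropFirst y0 m) meets
      corners (inj₂ _)     (inj₂ _)     (inj₁ meets) = peel (dropFirst x0 m) (dropLast y0 m) meets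
      corners (inj₂ (a , bottom , left)) (inj₂ (a′ , bottom′ , right)) (inj₂ (a″ , top , left″))
        with rowMissedByAtMostOne covered rowsOpen (first∈ y0 m) bottom bottom′
           | columnMissedByAtMostOne covered columnsOpen (first∈ x0 m) left left″
      ... | refl | refl = missedBoundary⇒large x-fits y-fits covered rowsOpen columnsOpen a bottom top left right

    covered⇒large : ∀ n x0 y0 → x0 + n ≤ k → y0 + n ≤ k → Covered x0 y0 n → RowsOpen x0 y0 n → Large x0 y0 n
    covered⇒large zero    _  _  _      _      _       _        = zero , noEdges
    covered⇒large (suc m) x0 y0 x-fits y-fits covered rowsOpen
      with all⊎any (λ t → eachColumnHas⊎someColumnLacks (X t) false x0 y0 (suc m))
    ... | inj₁ columnsOpen = cornerStep (covered⇒large m) x-fits y-fits covered rowsOpen columnsOpen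
    ... | inj₂ (t , x , x∈ , columnx) =
      t , mixedRowsCut x-fits y-fits (λ y y∈ → x , x∈ , columnx y y∈) (rowsOpen t)

  -- The tangle axioms

  smallOrComplementSmall : ∀ (S : VSet k) → mm≤ S k' → Small k S ⊎ Small k (complement S)
  smallOrComplementSmall S mm
    with eachRowHas⊎someRowLacks S false 0 0 k
  ... | inj₁ rowsOpen = inj₁ ((λ M isCut → s≤s (mm M isCut)) , noFullRow)
    where
    noFullRow : ∀ j → ¬ RowIn j S
    noFullRow j rowj =
      let x , _ , Sxj≡false = rowsOpen (toℕ j) (z≤n , toℕ<n j)
      in true-false⇒≢ (rowj (toFin x)) (subst (λ j′ → S (toFin x , j′) ≡ false) (toFin-toℕ j) Sxj≡false) refl
  ... | inj₂ (a , a∈ , rowa) = inj₂ ((λ M isCut → s≤s (mm≤-complement mm M isCut)) , noFullRow)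
    where
    noFullRow : ∀ j → ¬ RowIn j (complement S)
    noFullRow j rowj = 1+n≰n (≤-trans large (mm edges isCutMatching))
      where
      Sxj≡false : ∀ x → S (pt x (toℕ j)) ≡ false
      Sxj≡false x = subst (λ j′ → S (toFin x , j′) ≡ false) (sym (toFin-toℕ j)) (not-injective (rowj (toFin x)))
      open CutMatching≥ (mixedColumnsCut {X = S} ≤-refl ≤-refl (λ x x∈ → a , a∈ , rowa x x∈)
                                                               (λ x _ → toℕ j , (z≤n , toℕ<n j) , Sxj≡false x))

  noThreeSmallCover : ∀ (S₁ S₂ S₃ : VSet k) → Small k S₁ → Small k S₂ → Small k S₃ → ¬ Covers3 S₁ S₂ S₃
  noThreeSmallCover S₁ S₂ S₃ small₁ small₂ small₃ covers =
    tooLarge (covered⇒large k 0 0 ≤-refl ≤-refl covered rowsOpen)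
    where
    X : Fin 3 → VSet k
    X zero             = S₁
    X (suc zero)       = S₂
    X (suc (suc zero)) = S₃

    small : ∀ t → Small k (X t)
    small zero             = small₁
    small (suc zero)       = small₂
    small (suc (suc zero)) = small₃

    open ThreeSets X

    covered : Covered 0 0 k
    covered x y _ with ∨-true (covers (pt x y))
    ... | inj₁ S₁xy = zero , S₁xy
    ... | inj₂ S₂∨S₃ with ∨-true S₂∨S₃
    ...   | inj₁ S₂xy = suc zero , S₂xy
    ...   | inj₂ S₃xy = suc (suc zero) , S₃xy

    rowsOpen : RowsOpen 0 0 k
    rowsOpen t y _ with rangeSearch 0 k (λ x → ≡⊎≡not (X t (pt x y)) true)
    ... | inj₂ notFull = notFull
    ... | inj₁ full = ⊥-elim (proj₂ (small t) (toFin y) λ i →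
            subst (λ i′ → X t (i′ , toFin y) ≡ true) (toFin-toℕ i) (full (toℕ i) (z≤n , toℕ<n i)))

    tooLarge : ¬ Large 0 0 k
    tooLarge (t , M) = <⇒≱ (proj₁ (small t) edges isCutMatching) large
      where open CutMatching≥ M

  allButNotSmall : 1 ≤ k' → ∀ (x : V) → ¬ Small k (allBut x)
  allButNotSmall (s≤s z≤n) (_ , zero)  (_ , noFullRow) = noFullRow (suc zero) λ _ → cong not (∧-zeroʳ _)
  allButNotSmall (s≤s z≤n) (_ , suc _) (_ , noFullRow) = noFullRow zero λ _ → cong not (∧-zeroʳ _)

lemma4p6 : (k : ℕ) → 2 ≤ k → IsMMTangleOfSmall k
lemma4p6 (suc k') (s≤s 1≤k') = smallOrComplementSmall , noThreeSmallCover , allButNotSmall 1≤k'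
  where open Grid k'
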